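{- If $\dot G\in\mathcal{C}_1\cup\mathcal{C}_4\cup\mathcal{C}_5$ is a connected, non-complete, $5$-regular and $1$ net-regular strongly regular signed graph with parameters $(n,5,a,b,c)$, then $(a,b)\neq(0,1)$.
   Context: A signed graph $\dot G=(G,\sigma)$ is a simple graph $G$ (its underlying graph) with a sign function $\sigma:E(G)\to\{+1,-1\}$; its adjacency matrix $A_{\dot G}$ has $(i,j)$ entry $\sigma(v_iv_j)$ if $v_i\sim v_j$ and $0$ otherwise. Degree is the degree in $G$; $d^\pm(v)$ are the numbers of positive/negative edges at $v$; the net-degree is $d^+(v)-d^-(v)$, and $\dot G$ is $\rho$ net-regular if all net-degrees equal $\rho$. Connected/complete refer to $G$. $\dot G$ is homogeneous if all edges have the same sign, inhomogeneous otherwise. A signed graph on $n$ vertices is strongly regular (SRSG) if it is neither homogeneous complete nor edgeless and there are $r\in\mathbb N$, $a,b,c\in\mathbb Z$ with $(A^2_{\dot G})_{ii}=r$, $(A^2_{\dot G})_{ij}=a$ for positive edges $v_iv_j$, $=b$ for negative edges, $=c$ for distinct non-adjacent $v_i,v_j$; parameters $(n,r,a,b,c)$. Inhomogeneous SRSGs are divided into classes: $\mathcal{C}_1$: $a=-b$, and either complete or non-complete with $c\neq 0$; $\mathcal{C}_4$: $a\neq -b$, non-complete with $c=0$; $\mathcal{C}_5$: $a\ne -b$, non-complete with $c\neq\frac{a+b}{2}$ and $c\neq 0$. -}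

module Defs where

open import Data.Nat using (ℕ; zero; suc)
open import Data.Fin using (Fin; zero; suc)
open import Data.Integer using (ℤ; +_; -_; _+_; _*_; ∣_∣)
open import Data.Product using (_×_; Σ; ∃; ∃-syntax; _,_)
open import Data.Sum using (_⊎_)
open import Relation.Binary.PropositionalEquality using (_≡_; _≢_)
open import Relation.Nullary using (¬_)

∑ : ∀ {n} → (Fin n → ℤ) → ℤ
∑ {zero}  f = + 0
∑ {suc n} f = f zero + ∑ (λ i → f (suc i))

-- A signed graph on vertex set Fin n is given by its adjacency matrix
-- A : entries in {0, 1, -1}, symmetric, zero diagonal.
-- (A i j = σ(v_i v_j) if v_i ~ v_j, and 0 otherwise.)
Mat : ℕ → Set
Mat n = Fin n → Fin n → ℤ

IsSignedGraph : ∀ {n} → Mat n → Set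
IsSignedGraph {n} A =
  (∀ i j → (A i j ≡ + 0) ⊎ (A i j ≡ + 1) ⊎ (A i j ≡ - (+ 1)))
  × (∀ i j → A i j ≡ A j i)
  × (∀ i → A i i ≡ + 0)

Adj : ∀ {n} → Mat n → Fin n → Fin n → Set
Adj A i j = A i j ≢ + 0

PosEdge : ∀ {n} → Mat n → Fin n → Fin n → Set
PosEdge A i j = A i j ≡ + 1

NegEdge : ∀ {n} → Mat n → Fin n → Fin n → Set
NegEdge A i j = A i j ≡ - (+ 1)

Sq : ∀ {n} → Mat n → Mat n
Sq A i j = ∑ (λ k → A i k * A k j)

degree : ∀ {n} → Mat n → Fin n → ℤ
degree A v = ∑ (λ k → + ∣ A v k ∣)

netDegree : ∀ {n} → Mat n → Fin n → ℤ
netDegree A v = ∑ (λ k → A v k)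

Regular : ∀ {n} → Mat n → ℕ → Set
Regular A r = ∀ v → degree A v ≡ + r

NetRegular : ∀ {n} → Mat n → ℤ → Set
NetRegular A ρ = ∀ v → netDegree A v ≡ ρ

data Reach {n} (A : Mat n) : Fin n → Fin n → Set where
  here : ∀ {i} → Reach A i i
  step : ∀ {i j k} → Adj A i j → Reach A j k → Reach A i k

Connected : ∀ {n} → Mat n → Set
Connected A = ∀ i j → Reach A i j

Complete : ∀ {n} → Mat n → Set
Complete A = ∀ i j → i ≢ j → Adj A i j

Edgeless : ∀ {n} → Mat n → Set
Edgeless A = ∀ i j → A i j ≡ + 0

Homogeneous : ∀ {n} → Mat n → Set
Homogeneous A = (∀ i j → ¬ NegEdge A i j) ⊎ (∀ i j → ¬ PosEdge A i j)

Inhomogeneous : ∀ {n} → Mat n → Set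
Inhomogeneous A = (∃[ i ] ∃[ j ] PosEdge A i j) × (∃[ i ] ∃[ j ] NegEdge A i j)

IsSRSG : ∀ {n} → Mat n → ℕ → ℤ → ℤ → ℤ → Set
IsSRSG A r a b c =
  ¬ (Homogeneous A × Complete A)
  × ¬ Edgeless A
  × (∀ i → Sq A i i ≡ + r)
  × (∀ i j → PosEdge A i j → Sq A i j ≡ a)
  × (∀ i j → NegEdge A i j → Sq A i j ≡ b)
  × (∀ i j → i ≢ j → A i j ≡ + 0 → Sq A i j ≡ c)

C₁ : ∀ {n} → Mat n → ℤ → ℤ → ℤ → Set
C₁ A a b c = a ≡ - b × (Complete A ⊎ (¬ Complete A × c ≢ + 0))

C₄ : ∀ {n} → Mat n → ℤ → ℤ → ℤ → Set
C₄ A a b c = a ≢ - b × ¬ Complete A × c ≡ + 0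

-- c ≠ (a+b)/2 is expressed as 2c ≠ a + b
C₅ : ∀ {n} → Mat n → ℤ → ℤ → ℤ → Set
C₅ A a b c = a ≢ - b × ¬ Complete A × (+ 2 * c ≢ a + b) × c ≢ + 0

-- Writing A² through the SRSG parameters gives 2A² = 2cJ + (1 - 2c)|A| - A + (10 - 2c)I.
-- Comparing row sums (A² has row sums 1) yields c(n - 6) = -6, and n is even since 5n is
-- twice the number of edges, so (n, c) is (8, -3) or (12, -1). Because 1 - 2c is odd,
-- A commutes with |A|, so the number of common neighbours of u and v equals (A²)ᵤᵥ plus
-- four times the number of paths u -⁻- w -⁺- v; the latter has row sums 4 · 6.
-- For n = 12 the path count is exactly 4 on non-adjacent pairs and 0 on edges, so positive
-- edges have no common neighbour; a non-neighbour v of i then has a positive neighbour s that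
-- is also a non-neighbour of i, and the paths from i to v and to s give i four positive
-- neighbours. For n = 8 non-adjacent vertices have the same neighbourhood, so a common
-- neighbour of a vertex and one of its negative neighbours would have degree 6.
module Submission where

open import Defs
open import Data.Nat using (ℕ; zero; suc)
import Data.Nat as ℕ
open import Data.Nat.Divisibility using (_∣_; divides; ∣⇒≤; _∣?_)
open import Data.Nat.Coprimality using (coprime?; coprime-divisor)
open import Data.Integer
  using (ℤ; +_; -_; _+_; _*_; _-_; ∣_∣; _≤_; _<_; _≤?_; +≤+; +<+; ≢-nonZero; nonNegative)
import Data.Integer.Properties as ℤ
open import Data.Integer.Tactic.RingSolver using (solve-∀)
open import Data.Fin using (Fin; zero; suc)
open import Data.List using (List; []; _∷_; length)
open import Data.List.Relation.Unary.All using (All; []; _∷_)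
open import Data.List.Relation.Unary.AllPairs using ([]; _∷_)
open import Data.List.Relation.Unary.Unique.Propositional using (Unique)
open import Data.Product using (_×_; ∃; ∃-syntax; _,_; proj₁; proj₂)
open import Data.Sum using (_⊎_; inj₁; inj₂)
open import Data.Empty using (⊥; ⊥-elim)
open import Data.Unit using (tt)
open import Function using (_∘_)
open import Relation.Binary.PropositionalEquality
  using (_≡_; _≢_; refl; sym; trans; cong; cong₂; subst; subst₂; module ≡-Reasoning)
open import Relation.Nullary using (¬_; yes; no)
open import Relation.Nullary.Decidable using (False; toWitness; toWitnessFalse)
open import Algebra.Properties.AbelianGroup ℤ.+-0-abelianGroup using (∙-cancelˡ; ∙-cancelʳ)
open import Algebra.Properties.Semiring.Sum ℤ.+-*-semiring
  using (sum; sum-cong-≗; ∑-distrib-+; ∑-comm; *-distribˡ-sum)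

infeasible : ∀ {i j : ℤ} → False (i ≤? j) → ¬ i ≤ j
infeasible = toWitnessFalse

≡suc⇒≢0 : ∀ {x : ℤ} {m} → x ≡ + suc m → x ≢ + 0
≡suc⇒≢0 refl ()

≢-via : ∀ {X Y : Set} (f : X → Y) {y z : X} {v w : Y} → f y ≡ v → f z ≡ w → v ≢ w → y ≢ z
≢-via f fy≡v fz≡w v≢w refl = v≢w (trans (sym fy≡v) fz≡w)

-- Sums over Fin n

∑≡sum : ∀ {n} (f : Fin n → ℤ) → ∑ f ≡ sum f
∑≡sum {zero}  f = refl
∑≡sum {suc n} f = cong (_+_ (f zero)) (∑≡sum (f ∘ suc))

∑-cong : ∀ {n} {f g : Fin n → ℤ} → (∀ k → f k ≡ g k) → ∑ f ≡ ∑ g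
∑-cong {f = f} {g} f≗g = trans (∑≡sum f) (trans (sum-cong-≗ f≗g) (sym (∑≡sum g)))

∑-+ : ∀ {n} (f g : Fin n → ℤ) → ∑ (λ k → f k + g k) ≡ ∑ f + ∑ g
∑-+ f g = begin
  ∑ (λ k → f k + g k)    ≡⟨ ∑≡sum (λ k → f k + g k) ⟩
  sum (λ k → f k + g k)  ≡⟨ ∑-distrib-+ f g ⟩
  sum f + sum g          ≡⟨ cong₂ _+_ (∑≡sum f) (∑≡sum g) ⟨
  ∑ f + ∑ g              ∎
  where open ≡-Reasoning

∑-*ˡ : ∀ {n} (x : ℤ) (f : Fin n → ℤ) → ∑ (λ k → x * f k) ≡ x * ∑ f
∑-*ˡ x f = begin
  ∑ (λ k → x * f k)    ≡⟨ ∑≡sum (λ k → x * f k) ⟩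
  sum (λ k → x * f k)  ≡⟨ *-distribˡ-sum x f ⟨
  x * sum f            ≡⟨ cong (x *_) (∑≡sum f) ⟨
  x * ∑ f              ∎
  where open ≡-Reasoning

∑-*ʳ : ∀ {n} (x : ℤ) (f : Fin n → ℤ) → ∑ (λ k → f k * x) ≡ ∑ f * x
∑-*ʳ x f = trans (∑-cong (λ k → ℤ.*-comm (f k) x)) (trans (∑-*ˡ x f) (ℤ.*-comm x (∑ f)))

∑-neg : ∀ {n} (f : Fin n → ℤ) → ∑ (λ k → - f k) ≡ - ∑ f
∑-neg f = begin
  ∑ (λ k → - f k)       ≡⟨ ∑-cong (λ k → ℤ.-1*i≡-i (f k)) ⟨
  ∑ (λ k → - + 1 * f k) ≡⟨ ∑-*ˡ (- + 1) f ⟩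
  - + 1 * ∑ f           ≡⟨ ℤ.-1*i≡-i (∑ f) ⟩
  - ∑ f                 ∎
  where open ≡-Reasoning

∑-- : ∀ {n} (f g : Fin n → ℤ) → ∑ (λ k → f k - g k) ≡ ∑ f - ∑ g
∑-- f g = trans (∑-+ f (λ k → - g k)) (cong (_+_ (∑ f)) (∑-neg g))

∑-linear : ∀ {n} (α β γ μ : ℤ) (f g h e : Fin n → ℤ) →
  ∑ (λ k → α * f k + β * g k + γ * h k + μ * e k) ≡ α * ∑ f + β * ∑ g + γ * ∑ h + μ * ∑ e
∑-linear α β γ μ f g h e = begin
  ∑ (λ k → αf k + βg k + γh k + μe k)           ≡⟨ ∑-+ (λ k → αf k + βg k + γh k) μe ⟩
  ∑ (λ k → αf k + βg k + γh k) + ∑ μe           ≡⟨ cong (_+ ∑ μe) (∑-+ (λ k → αf k + βg k) γh) ⟩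
  ∑ (λ k → αf k + βg k) + ∑ γh + ∑ μe           ≡⟨ cong (λ s → s + ∑ γh + ∑ μe) (∑-+ αf βg) ⟩
  ∑ αf + ∑ βg + ∑ γh + ∑ μe
    ≡⟨ cong₂ _+_ (cong₂ _+_ (cong₂ _+_ (∑-*ˡ α f) (∑-*ˡ β g)) (∑-*ˡ γ h)) (∑-*ˡ μ e) ⟩
  α * ∑ f + β * ∑ g + γ * ∑ h + μ * ∑ e         ∎
  where
  open ≡-Reasoning
  αf βg γh μe : Fin _ → ℤ
  αf k = α * f k
  βg k = β * g k
  γh k = γ * h k
  μe k = μ * e k

∑-one : ∀ n → ∑ {n} (λ _ → + 1) ≡ + n
∑-one zero    = refl
∑-one (suc n) = trans (cong (_+_ (+ 1)) (∑-one n)) (sym (ℤ.pos-+ 1 n))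

∑-swap : ∀ {m n} (f : Fin m → Fin n → ℤ) → ∑ (λ i → ∑ (f i)) ≡ ∑ (λ j → ∑ (λ i → f i j))
∑-swap f = begin
  ∑ (λ i → ∑ (f i))              ≡⟨ ∑-cong (λ i → ∑≡sum (f i)) ⟩
  ∑ (λ i → sum (f i))            ≡⟨ ∑≡sum (λ i → sum (f i)) ⟩
  sum (λ i → sum (f i))          ≡⟨ ∑-comm f ⟩
  sum (λ j → sum (λ i → f i j))  ≡⟨ ∑≡sum (λ j → sum (λ i → f i j)) ⟨
  ∑ (λ j → sum (λ i → f i j))    ≡⟨ ∑-cong (λ j → ∑≡sum (λ i → f i j)) ⟨
  ∑ (λ j → ∑ (λ i → f i j))      ∎
  where open ≡-Reasoning

δ : ∀ {n} → Fin n → Fin n → ℤ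
δ zero    zero    = + 1
δ zero    (suc _) = + 0
δ (suc _) zero    = + 0
δ (suc i) (suc j) = δ i j

δ-refl : ∀ {n} (i : Fin n) → δ i i ≡ + 1
δ-refl zero    = refl
δ-refl (suc i) = δ-refl i

δ-≢ : ∀ {n} {i j : Fin n} → i ≢ j → δ i j ≡ + 0
δ-≢ {i = zero}  {zero}  i≢j = ⊥-elim (i≢j refl)
δ-≢ {i = zero}  {suc j} i≢j = refl
δ-≢ {i = suc i} {zero}  i≢j = refl
δ-≢ {i = suc i} {suc j} i≢j = δ-≢ (i≢j ∘ cong suc)

δ-sym : ∀ {n} (i j : Fin n) → δ i j ≡ δ j i
δ-sym zero    zero    = refl
δ-sym zero    (suc j) = refl
δ-sym (suc i) zero    = refl
δ-sym (suc i) (suc j) = δ-sym i j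

∑-zero : ∀ n → ∑ {n} (λ _ → + 0) ≡ + 0
∑-zero n = ∑-*ˡ {n} (+ 0) (λ _ → + 0)

∑-δʳ : ∀ {n} (f : Fin n → ℤ) (j : Fin n) → ∑ (λ k → f k * δ k j) ≡ f j
∑-δʳ {suc n} f zero = begin
  f zero * + 1 + ∑ (λ k → f (suc k) * + 0)
    ≡⟨ cong₂ _+_ (ℤ.*-identityʳ (f zero)) (∑-cong (ℤ.*-zeroʳ ∘ f ∘ suc)) ⟩
  f zero + ∑ {n} (λ _ → + 0)                ≡⟨ cong (_+_ (f zero)) (∑-zero n) ⟩
  f zero + + 0                              ≡⟨ ℤ.+-identityʳ (f zero) ⟩
  f zero                                    ∎
  where open ≡-Reasoning
∑-δʳ {suc n} f (suc j) =
  trans (cong₂ _+_ (ℤ.*-zeroʳ (f zero)) (∑-δʳ (f ∘ suc) j)) (ℤ.+-identityˡ (f (suc j)))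

∑-δˡ : ∀ {n} (f : Fin n → ℤ) (i : Fin n) → ∑ (λ k → δ i k * f k) ≡ f i
∑-δˡ f i = trans (∑-cong (λ k → trans (ℤ.*-comm (δ i k) (f k)) (cong (f k *_) (δ-sym i k)))) (∑-δʳ f i)

∑-δ-one : ∀ {n} (i : Fin n) → ∑ (δ i) ≡ + 1
∑-δ-one i = trans (∑-cong (λ j → sym (ℤ.*-identityʳ (δ i j)))) (∑-δˡ (λ _ → + 1) i)

δ-cases : ∀ {n} (i j : Fin n) → (i ≡ j × δ i j ≡ + 1) ⊎ (i ≢ j × δ i j ≡ + 0)
δ-cases i j with i Data.Fin.≟ j
... | yes refl = inj₁ (refl , δ-refl i)
... | no i≢j   = inj₂ (i≢j , δ-≢ i≢j)

zeroAt : ∀ {n} → Fin n → (Fin n → ℤ) → Fin n → ℤ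
zeroAt p f k = (+ 1 - δ k p) * f k

zeroAt-self : ∀ {n} (p : Fin n) (f : Fin n → ℤ) → zeroAt p f p ≡ + 0
zeroAt-self p f = cong (λ d → (+ 1 - d) * f p) (δ-refl p)

zeroAt-≢ : ∀ {n} {p k : Fin n} (f : Fin n → ℤ) → k ≢ p → zeroAt p f k ≡ f k
zeroAt-≢ {k = k} f k≢p = trans (cong (λ d → (+ 1 - d) * f k) (δ-≢ k≢p)) (ℤ.*-identityˡ (f k))

zeroAt-mono : ∀ {n} (p : Fin n) {f g : Fin n → ℤ} → (∀ k → f k ≤ g k) → ∀ k → zeroAt p f k ≤ zeroAt p g k
zeroAt-mono p {f} {g} f≤g k with δ-cases k p
... | inj₁ (refl , _) = ℤ.≤-reflexive (trans (zeroAt-self p f) (sym (zeroAt-self p g)))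
... | inj₂ (k≢p , _)  = subst₂ _≤_ (sym (zeroAt-≢ f k≢p)) (sym (zeroAt-≢ g k≢p)) (f≤g k)

∑-extract : ∀ {n} (f : Fin n → ℤ) (p : Fin n) → ∑ f ≡ f p + ∑ (zeroAt p f)
∑-extract f p = begin
  ∑ f                                              ≡⟨ ∑-cong (λ k → split (f k) (δ k p)) ⟩
  ∑ (λ k → f k * δ k p + zeroAt p f k)             ≡⟨ ∑-+ (λ k → f k * δ k p) (zeroAt p f) ⟩
  ∑ (λ k → f k * δ k p) + ∑ (zeroAt p f)           ≡⟨ cong (_+ ∑ (zeroAt p f)) (∑-δʳ f p) ⟩
  f p + ∑ (zeroAt p f)                             ∎
  where
  open ≡-Reasoning
  split : ∀ x d → x ≡ x * d + (+ 1 - d) * x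
  split = solve-∀

NonNeg : ∀ {n} → (Fin n → ℤ) → Set
NonNeg f = ∀ k → + 0 ≤ f k

zeroAt-nonNeg : ∀ {n} (p : Fin n) {f : Fin n → ℤ} → NonNeg f → NonNeg (zeroAt p f)
zeroAt-nonNeg p {f} f≥0 k = subst (_≤ zeroAt p f k) (ℤ.*-zeroʳ (+ 1 - δ k p)) (zeroAt-mono p f≥0 k)

∑-nonNeg : ∀ {n} (f : Fin n → ℤ) → NonNeg f → + 0 ≤ ∑ f
∑-nonNeg {zero}  f f≥0 = ℤ.≤-refl
∑-nonNeg {suc n} f f≥0 = ℤ.+-mono-≤ (f≥0 zero) (∑-nonNeg (f ∘ suc) (f≥0 ∘ suc))

∑-mono : ∀ {n} {f g : Fin n → ℤ} → (∀ k → f k ≤ g k) → ∑ f ≤ ∑ g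
∑-mono {zero}  f≤g = ℤ.≤-refl
∑-mono {suc n} f≤g = ℤ.+-mono-≤ (f≤g zero) (∑-mono (f≤g ∘ suc))

term≤∑ : ∀ {n} (f : Fin n → ℤ) → NonNeg f → ∀ p → f p ≤ ∑ f
term≤∑ f f≥0 p = subst (f p ≤_) (sym (∑-extract f p)) (ℤ.i≤i+j (f p) (∑ (zeroAt p f))
  ⦃ Data.Integer.nonNegative (∑-nonNeg (zeroAt p f) (zeroAt-nonNeg p f≥0)) ⦄)

∑≡0⇒≡0 : ∀ {n} (f : Fin n → ℤ) → NonNeg f → ∑ f ≡ + 0 → ∀ k → f k ≡ + 0
∑≡0⇒≡0 f f≥0 ∑≡0 k = ℤ.≤-antisym (subst (f k ≤_) ∑≡0 (term≤∑ f f≥0 k)) (f≥0 k)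

∑≢0⇒∃≢0 : ∀ {n} (f : Fin n → ℤ) → ∑ f ≢ + 0 → ∃[ k ] f k ≢ + 0
∑≢0⇒∃≢0 {zero}  f ∑≢0 = ⊥-elim (∑≢0 refl)
∑≢0⇒∃≢0 {suc n} f ∑≢0 with f zero ℤ.≟ + 0
... | no f0≢0 = zero , f0≢0
... | yes f0≡0 with ∑≢0⇒∃≢0 (f ∘ suc) (λ ∑≡0 → ∑≢0 (cong₂ _+_ f0≡0 ∑≡0))
...   | k , fk≢0 = suc k , fk≢0

zeroAt-cases : ∀ {n} (p : Fin n) (f : Fin n → ℤ) k → zeroAt p f k ≡ + 0 ⊎ zeroAt p f k ≡ f k
zeroAt-cases p f k with δ-cases k p
... | inj₁ (refl , _) = inj₁ (zeroAt-self p f)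
... | inj₂ (k≢p , _)  = inj₂ (zeroAt-≢ f k≢p)

ZeroOr : ∀ {n} → ℕ → (Fin n → ℤ) → Set
ZeroOr d f = ∀ k → f k ≡ + 0 ⊎ f k ≡ + d

ZeroOr⇒NonNeg : ∀ {n} {d} {f : Fin n → ℤ} → ZeroOr d f → NonNeg f
ZeroOr⇒NonNeg f∈ k with f∈ k
... | inj₁ fk≡0 = ℤ.≤-reflexive (sym fk≡0)
... | inj₂ fk≡d = subst (+ 0 ≤_) (sym fk≡d) (+≤+ ℕ.z≤n)

ZeroOr-pick : ∀ {n} d (f : Fin n → ℤ) → ZeroOr d f → ∑ f ≢ + 0 → ∃[ j ] f j ≡ + d
ZeroOr-pick d f f∈ ∑≢0 with ∑≢0⇒∃≢0 f ∑≢0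
... | j , fj≢0 with f∈ j
...   | inj₁ fj≡0 = ⊥-elim (fj≢0 fj≡0)
...   | inj₂ fj≡d = j , fj≡d

zeroAt-ZeroOr : ∀ {n} {d} (p : Fin n) {f : Fin n → ℤ} → ZeroOr d f → ZeroOr d (zeroAt p f)
zeroAt-ZeroOr {d = d} p {f} f∈ k with zeroAt-cases p f k
... | inj₁ ≡0 = inj₁ ≡0
... | inj₂ ≡f = subst (λ x → x ≡ + 0 ⊎ x ≡ + d) (sym ≡f) (f∈ k)

∑-ZeroOr-≢0 : ∀ {n} d (f : Fin n → ℤ) → ZeroOr d f → ∑ f ≢ + 0 → + d ≤ ∑ f
∑-ZeroOr-≢0 d f f∈ ∑≢0 with ZeroOr-pick d f f∈ ∑≢0
... | j , fj≡d = subst (_≤ ∑ f) fj≡d (term≤∑ f (ZeroOr⇒NonNeg f∈) j)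

∑-ZeroOr-> : ∀ {n} d (f : Fin n → ℤ) → ZeroOr d f → + d < ∑ f → + d + + d ≤ ∑ f
∑-ZeroOr-> d f f∈ d<∑
  with ZeroOr-pick d f f∈ (λ ∑≡0 → ℤ.<⇒≱ d<∑ (ℤ.≤-trans (ℤ.≤-reflexive ∑≡0) (+≤+ ℕ.z≤n)))
... | j , fj≡d = subst (+ d + + d ≤_) (sym ∑f≡)
                   (ℤ.+-monoʳ-≤ (+ d) (∑-ZeroOr-≢0 d (zeroAt j f) (zeroAt-ZeroOr j f∈) rest≢0))
  where
  ∑f≡ : ∑ f ≡ + d + ∑ (zeroAt j f)
  ∑f≡ = trans (∑-extract f j) (cong (_+ ∑ (zeroAt j f)) fj≡d)
  rest≢0 : ∑ (zeroAt j f) ≢ + 0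
  rest≢0 rest≡0 = ℤ.<-irrefl refl
    (subst (+ d <_) (trans ∑f≡ (trans (cong (_+_ (+ d)) rest≡0) (ℤ.+-identityʳ (+ d)))) d<∑)

∑≡2⇒two-ones : ∀ {n} (f : Fin n → ℤ) → ZeroOr 1 f → ∑ f ≡ + 2 →
  ∃[ j ] ∃[ j′ ] j ≢ j′ × f j ≡ + 1 × f j′ ≡ + 1
∑≡2⇒two-ones f f∈ ∑≡2 with ZeroOr-pick 1 f f∈ (≡suc⇒≢0 ∑≡2)
... | j , fj≡1 with ZeroOr-pick 1 (zeroAt j f) (zeroAt-ZeroOr j f∈) (≡suc⇒≢0 rest≡1)
  where
  rest≡1 : ∑ (zeroAt j f) ≡ + 1
  rest≡1 = trans (unshift (∑ (zeroAt j f)))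
    (cong (_- + 1) (trans (cong (_+ ∑ (zeroAt j f)) (sym fj≡1)) (trans (sym (∑-extract f j)) ∑≡2)))
    where
    unshift : ∀ x → x ≡ + 1 + x - + 1
    unshift = solve-∀
...   | j′ , restj′≡1 = j , j′ , j≢j′ , fj≡1 , trans (sym (zeroAt-≢ f (j≢j′ ∘ sym))) restj′≡1
  where
  j≢j′ : j ≢ j′
  j≢j′ refl = ≡suc⇒≢0 restj′≡1 (zeroAt-self j f)

∑ᴸ : ∀ {n} → (Fin n → ℤ) → List (Fin n) → ℤ
∑ᴸ f []       = + 0
∑ᴸ f (k ∷ ks) = f k + ∑ᴸ f ks

∑ᴸ-const : ∀ {n} {f : Fin n → ℤ} {v} {ks} → All (λ k → f k ≡ v) ks → ∑ᴸ f ks ≡ + length ks * v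
∑ᴸ-const {v = v} [] = sym (ℤ.*-zeroˡ v)
∑ᴸ-const {v = v} {k ∷ ks} (fk≡v ∷ rest) = trans (cong₂ _+_ fk≡v (∑ᴸ-const rest)) (distrib v (+ length ks))
  where
  distrib : ∀ v m → v + m * v ≡ (+ 1 + m) * v
  distrib = solve-∀

∑ᴸ-zeroAt : ∀ {n} (p : Fin n) (f : Fin n → ℤ) {ks} → All (p ≢_) ks → ∑ᴸ (zeroAt p f) ks ≡ ∑ᴸ f ks
∑ᴸ-zeroAt p f []            = refl
∑ᴸ-zeroAt p f (p≢k ∷ p≢ks) = cong₂ _+_ (zeroAt-≢ f (p≢k ∘ sym)) (∑ᴸ-zeroAt p f p≢ks)

∑ᴸ≤∑ : ∀ {n} (f : Fin n → ℤ) → NonNeg f → ∀ {ks} → Unique ks → ∑ᴸ f ks ≤ ∑ f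
∑ᴸ≤∑ f f≥0 []                        = ∑-nonNeg f f≥0
∑ᴸ≤∑ f f≥0 {p ∷ ks} (p≢ks ∷ unique) =
  subst₂ _≤_ (cong (_+_ (f p)) (∑ᴸ-zeroAt p f p≢ks)) (sym (∑-extract f p))
    (ℤ.+-monoʳ-≤ (f p) (∑ᴸ≤∑ (zeroAt p f) (zeroAt-nonNeg p f≥0) unique))

count≤∑ : ∀ {n} (f : Fin n → ℤ) → NonNeg f → ∀ {v ks} → Unique ks → All (λ k → f k ≡ v) ks →
          + length ks * v ≤ ∑ f
count≤∑ f f≥0 unique f≡v = subst (_≤ ∑ f) (∑ᴸ-const f≡v) (∑ᴸ≤∑ f f≥0 unique)

∑-mono-gap : ∀ {n} {f g : Fin n → ℤ} (p : Fin n) {d} →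
  (∀ k → f k ≤ g k) → f p + d ≤ g p → ∑ f + d ≤ ∑ g
∑-mono-gap {f = f} {g} p {d} f≤g gap = begin
  ∑ f + d                            ≡⟨ cong (_+ d) (∑-extract f p) ⟩
  f p + ∑ (zeroAt p f) + d           ≡⟨ swap (f p) (∑ (zeroAt p f)) d ⟩
  f p + d + ∑ (zeroAt p f)           ≤⟨ ℤ.+-mono-≤ gap (∑-mono (zeroAt-mono p f≤g)) ⟩
  g p + ∑ (zeroAt p g)               ≡⟨ ∑-extract g p ⟨
  ∑ g                                ∎
  where
  open ℤ.≤-Reasoning
  swap : ∀ x y z → x + y + z ≡ x + z + y
  swap = solve-∀

handshake : ∀ {m} (M : Mat m) → (∀ i j → M i j ≡ M j i) → (∀ i → M i i ≡ + 0) →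
  ∃[ t ] ∑ (λ i → ∑ (M i)) ≡ t + t
handshake {zero}  M M-sym M-diag = + 0 , refl
handshake {suc m} M M-sym M-diag
  with handshake (λ i j → M (suc i) (suc j)) (λ i j → M-sym (suc i) (suc j)) (M-diag ∘ suc)
... | t , ∑∑≡t+t = R + t , (begin
    M zero zero + R + ∑ (λ i → M (suc i) zero + ∑ (λ j → M (suc i) (suc j)))
      ≡⟨ cong₂ _+_ (cong (_+ R) (M-diag zero))
                   (∑-+ (λ i → M (suc i) zero) (λ i → ∑ (λ j → M (suc i) (suc j)))) ⟩
    + 0 + R + (∑ (λ i → M (suc i) zero) + ∑ (λ i → ∑ (λ j → M (suc i) (suc j))))
      ≡⟨ cong₂ (λ x y → + 0 + R + (x + y)) (∑-cong (λ i → M-sym (suc i) zero)) ∑∑≡t+t ⟩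
    + 0 + R + (R + (t + t))
      ≡⟨ regroup R t ⟩
    R + t + (R + t) ∎)
  where
  open ≡-Reasoning
  R : ℤ
  R = ∑ (λ j → M zero (suc j))
  regroup : ∀ R t → + 0 + R + (R + (t + t)) ≡ R + t + (R + t)
  regroup = solve-∀

*-distribˡ-+₄ : ∀ x p q u v → x * (p + q + u + v) ≡ x * p + x * q + x * u + x * v
*-distribˡ-+₄ x p q u v =
  trans (ℤ.*-distribˡ-+ x (p + q + u) v)
        (cong (_+ x * v) (trans (ℤ.*-distribˡ-+ x (p + q) u) (cong (_+ x * u) (ℤ.*-distribˡ-+ x p q))))

*-distribʳ-+₄ : ∀ x p q u v → (p + q + u + v) * x ≡ p * x + q * x + u * x + v * x
*-distribʳ-+₄ x p q u v =
  trans (ℤ.*-distribʳ-+ x (p + q + u) v)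
        (cong (_+ v * x) (trans (ℤ.*-distribʳ-+ x (p + q) u) (cong (_+ u * x) (ℤ.*-distribʳ-+ x p q))))

Sq-assoc : ∀ {n} (A : Mat n) i j → ∑ (λ k → A i k * Sq A k j) ≡ ∑ (λ k → Sq A i k * A k j)
Sq-assoc A i j = begin
  ∑ (λ k → A i k * ∑ (λ l → A k l * A l j))    ≡⟨ ∑-cong (λ k → ∑-*ˡ (A i k) (λ l → A k l * A l j)) ⟨
  ∑ (λ k → ∑ (λ l → A i k * (A k l * A l j)))  ≡⟨ ∑-swap (λ k l → A i k * (A k l * A l j)) ⟩
  ∑ (λ l → ∑ (λ k → A i k * (A k l * A l j)))
    ≡⟨ ∑-cong (λ l → ∑-cong (λ k → ℤ.*-assoc (A i k) (A k l) (A l j))) ⟨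
  ∑ (λ l → ∑ (λ k → A i k * A k l * A l j))    ≡⟨ ∑-cong (λ l → ∑-*ʳ (A l j) (λ k → A i k * A k l)) ⟩
  ∑ (λ l → Sq A i l * A l j)                   ∎
  where open ≡-Reasoning

-- Entries of a signed adjacency matrix

Entry : ℤ → Set
Entry x = x ≡ + 0 ⊎ x ≡ + 1 ⊎ x ≡ - + 1

pattern is0  = inj₁ refl
pattern is+1 = inj₂ (inj₁ refl)
pattern is-1 = inj₂ (inj₂ refl)

abs : ℤ → ℤ
abs x = + ∣ x ∣

-- Four times the indicator of (x , y) = (-1 , +1).
negPos : ℤ → ℤ → ℤ
negPos x y = (abs x - x) * (abs y + y)

-- Twice the indicator of x = y ≠ 0.
sameSign : ℤ → ℤ → ℤ
sameSign x y = abs x * abs y + x * y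

negPos-cases : ∀ {x y} → Entry x → Entry y →
  negPos x y ≡ + 0 ⊎ (negPos x y ≡ + 4 × x ≡ - + 1 × y ≡ + 1)
negPos-cases is-1 is+1 = inj₂ (refl , refl , refl)
negPos-cases is0  _    = inj₁ refl
negPos-cases is+1 _    = inj₁ refl
negPos-cases is-1 is0  = inj₁ refl
negPos-cases is-1 is-1 = inj₁ refl

negPos-0or4 : ∀ {x y} → Entry x → Entry y → negPos x y ≡ + 0 ⊎ negPos x y ≡ + 4
negPos-0or4 x∈ y∈ with negPos-cases x∈ y∈
... | inj₁ ≡0       = inj₁ ≡0
... | inj₂ (≡4 , _) = inj₂ ≡4

negPos≢0 : ∀ {x y} → Entry x → Entry y → negPos x y ≢ + 0 → x ≡ - + 1 × y ≡ + 1
negPos≢0 x∈ y∈ ≢0 with negPos-cases x∈ y∈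
... | inj₁ ≡0                   = ⊥-elim (≢0 ≡0)
... | inj₂ (_ , x≡-1 , y≡+1) = x≡-1 , y≡+1

abs*abs-nonNeg : ∀ x y → + 0 ≤ abs x * abs y
abs*abs-nonNeg x y = subst (+ 0 ≤_) (ℤ.pos-* ∣ x ∣ ∣ y ∣) (+≤+ ℕ.z≤n)

abs*abs≢0 : ∀ {x y} → Entry x → Entry y → abs x * abs y ≢ + 0 → abs x ≡ + 1 × abs y ≡ + 1
abs*abs≢0 is0  _    ≢0 = ⊥-elim (≢0 refl)
abs*abs≢0 is+1 is0  ≢0 = ⊥-elim (≢0 refl)
abs*abs≢0 is-1 is0  ≢0 = ⊥-elim (≢0 refl)
abs*abs≢0 is+1 is+1 _  = refl , refl
abs*abs≢0 is+1 is-1 _  = refl , refl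
abs*abs≢0 is-1 is+1 _  = refl , refl
abs*abs≢0 is-1 is-1 _  = refl , refl

abs≤1 : ∀ {x} → Entry x → abs x ≤ + 1
abs≤1 is0  = +≤+ ℕ.z≤n
abs≤1 is+1 = ℤ.≤-refl
abs≤1 is-1 = ℤ.≤-refl

abs*abs≤abs : ∀ x {y} → Entry y → abs x * abs y ≤ abs x
abs*abs≤abs x {y} y∈ = subst (abs x * abs y ≤_) (ℤ.*-identityʳ (abs x))
  (ℤ.*-monoˡ-≤-nonNeg (abs x) (abs≤1 y∈))

sameSign-nonNeg : ∀ {x y} → Entry x → Entry y → + 0 ≤ sameSign x y
sameSign-nonNeg is0  _    = +≤+ ℕ.z≤n
sameSign-nonNeg is+1 is0  = +≤+ ℕ.z≤n
sameSign-nonNeg is+1 is+1 = +≤+ ℕ.z≤n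
sameSign-nonNeg is+1 is-1 = +≤+ ℕ.z≤n
sameSign-nonNeg is-1 is0  = +≤+ ℕ.z≤n
sameSign-nonNeg is-1 is+1 = +≤+ ℕ.z≤n
sameSign-nonNeg is-1 is-1 = +≤+ ℕ.z≤n

sameSign≢0 : ∀ {x y} → Entry x → Entry y → sameSign x y ≢ + 0 →
  (x ≡ + 1 × y ≡ + 1) ⊎ (x ≡ - + 1 × y ≡ - + 1)
sameSign≢0 is+1 is+1 _  = inj₁ (refl , refl)
sameSign≢0 is-1 is-1 _  = inj₂ (refl , refl)
sameSign≢0 is0  _    ≢0 = ⊥-elim (≢0 refl)
sameSign≢0 is+1 is0  ≢0 = ⊥-elim (≢0 refl)
sameSign≢0 is+1 is-1 ≢0 = ⊥-elim (≢0 refl)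
sameSign≢0 is-1 is0  ≢0 = ⊥-elim (≢0 refl)
sameSign≢0 is-1 is+1 ≢0 = ⊥-elim (≢0 refl)

abs+x-nonNeg : ∀ {x} → Entry x → + 0 ≤ abs x + x
abs+x-nonNeg is0  = +≤+ ℕ.z≤n
abs+x-nonNeg is+1 = +≤+ ℕ.z≤n
abs+x-nonNeg is-1 = +≤+ ℕ.z≤n

abs-x-nonNeg : ∀ {x} → Entry x → + 0 ≤ abs x - x
abs-x-nonNeg is0  = +≤+ ℕ.z≤n
abs-x-nonNeg is+1 = +≤+ ℕ.z≤n
abs-x-nonNeg is-1 = +≤+ ℕ.z≤n

abs-x≢0 : ∀ {x} → Entry x → abs x - x ≢ + 0 → x ≡ - + 1
abs-x≢0 is0  ≢0 = ⊥-elim (≢0 refl)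
abs-x≢0 is+1 ≢0 = ⊥-elim (≢0 refl)
abs-x≢0 is-1 _  = refl

pos*abs≤2abs*abs : ∀ {x y} → Entry x → Entry y → (abs y + y) * abs x ≤ + 2 * (abs x * abs y)
pos*abs≤2abs*abs is0  is0  = ℤ.≤-refl
pos*abs≤2abs*abs is0  is+1 = ℤ.≤-refl
pos*abs≤2abs*abs is0  is-1 = ℤ.≤-refl
pos*abs≤2abs*abs is+1 is0  = ℤ.≤-refl
pos*abs≤2abs*abs is+1 is+1 = ℤ.≤-refl
pos*abs≤2abs*abs is+1 is-1 = +≤+ ℕ.z≤n
pos*abs≤2abs*abs is-1 is0  = ℤ.≤-refl
pos*abs≤2abs*abs is-1 is+1 = ℤ.≤-refl
pos*abs≤2abs*abs is-1 is-1 = +≤+ ℕ.z≤n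

pos*[1-abs]≢0 : ∀ {y z} → Entry y → Entry z → (abs y + y) * (+ 1 - abs z) ≢ + 0 → y ≡ + 1 × z ≡ + 0
pos*[1-abs]≢0 is+1 is0  _  = refl , refl
pos*[1-abs]≢0 is0  _    ≢0 = ⊥-elim (≢0 refl)
pos*[1-abs]≢0 is-1 _    ≢0 = ⊥-elim (≢0 refl)
pos*[1-abs]≢0 is+1 is+1 ≢0 = ⊥-elim (≢0 refl)
pos*[1-abs]≢0 is+1 is-1 ≢0 = ⊥-elim (≢0 refl)

abs≢0 : ∀ {x} → Entry x → abs x ≢ + 0 → abs x ≡ + 1
abs≢0 is0  ≢0 = ⊥-elim (≢0 refl)
abs≢0 is+1 _  = refl
abs≢0 is-1 _  = refl

-- Walks of length two in a signed graph

module SignedGraph {n : ℕ} (A : Mat n)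
  (entry : ∀ i j → Entry (A i j))
  (A-sym : ∀ i j → A i j ≡ A j i)
  (A-diag : ∀ i → A i i ≡ + 0)
  where

  _≁_ : Fin n → Fin n → Set
  i ≁ j = i ≢ j × A i j ≡ + 0

  ≁-sym : ∀ {i j} → i ≁ j → j ≁ i
  ≁-sym {i} {j} (i≢j , Aij≡0) = i≢j ∘ sym , trans (A-sym j i) Aij≡0

  common negPosWalks sameSignWalks : Fin n → Fin n → ℤ
  common        i j = ∑ (λ k → abs (A i k) * abs (A k j))
  negPosWalks   i j = ∑ (λ k → negPos (A i k) (A k j))
  sameSignWalks i j = ∑ (λ k → sameSign (A i k) (A k j))

  common-nonNeg : ∀ i j → + 0 ≤ common i j
  common-nonNeg i j = ∑-nonNeg _ (λ k → abs*abs-nonNeg (A i k) (A k j))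

  negPosWalks-0or4 : ∀ i j → ZeroOr 4 (λ k → negPos (A i k) (A k j))
  negPosWalks-0or4 i j k = negPos-0or4 (entry i k) (entry k j)

  negPosWalks-nonNeg : ∀ i j → + 0 ≤ negPosWalks i j
  negPosWalks-nonNeg i j = ∑-nonNeg _ (ZeroOr⇒NonNeg (negPosWalks-0or4 i j))

  sameSignWalks≡ : ∀ i j → sameSignWalks i j ≡ common i j + Sq A i j
  sameSignWalks≡ i j = ∑-+ (λ k → abs (A i k) * abs (A k j)) (λ k → A i k * A k j)

  sameSignWalks-nonNeg : ∀ i j → + 0 ≤ sameSignWalks i j
  sameSignWalks-nonNeg i j = ∑-nonNeg _ (λ k → sameSign-nonNeg (entry i k) (entry k j))

  ∣A∣-Commutes : Set
  ∣A∣-Commutes = ∀ i j → ∑ (λ k → A i k * abs (A k j)) ≡ ∑ (λ k → abs (A i k) * A k j)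

  -- |x||y| = xy + (|x| - x)(|y| + y) + (x|y| - |x|y), and the last term sums to zero.
  common≡Sq+negPosWalks : ∣A∣-Commutes → ∀ i j → common i j ≡ Sq A i j + negPosWalks i j
  common≡Sq+negPosWalks commutes i j = begin
    common i j
      ≡⟨ ∑-cong (λ k → split (A i k) (A k j) (abs (A i k)) (abs (A k j))) ⟩
    ∑ (λ k → A i k * A k j + negPos (A i k) (A k j) + (A i k * abs (A k j) - abs (A i k) * A k j))
      ≡⟨ ∑-+ (λ k → A i k * A k j + negPos (A i k) (A k j)) _ ⟩
    ∑ (λ k → A i k * A k j + negPos (A i k) (A k j)) + ∑ (λ k → A i k * abs (A k j) - abs (A i k) * A k j)
      ≡⟨ cong₂ _+_ (∑-+ (λ k → A i k * A k j) _) (∑-- (λ k → A i k * abs (A k j)) _) ⟩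
    Sq A i j + negPosWalks i j + (∑ (λ k → A i k * abs (A k j)) - ∑ (λ k → abs (A i k) * A k j))
      ≡⟨ cong (λ d → Sq A i j + negPosWalks i j + d) (ℤ.i≡j⇒i-j≡0 (commutes i j)) ⟩
    Sq A i j + negPosWalks i j + + 0
      ≡⟨ ℤ.+-identityʳ _ ⟩
    Sq A i j + negPosWalks i j ∎
    where
    open ≡-Reasoning
    split : ∀ x y ax ay → ax * ay ≡ x * y + (ax - x) * (ay + y) + (x * ay - ax * y)
    split = solve-∀

  common≢0 : ∀ {u v} → common u v ≢ + 0 → ∃[ w ] abs (A u w) ≡ + 1 × abs (A w v) ≡ + 1
  common≢0 {u} {v} ≢0 with ∑≢0⇒∃≢0 (λ k → abs (A u k) * abs (A k v)) ≢0
  ... | w , term≢0 = w , abs*abs≢0 (entry u w) (entry w v) term≢0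

  negPosWalks≢0 : ∀ {u v} → negPosWalks u v ≢ + 0 → ∃[ w ] A u w ≡ - + 1 × A w v ≡ + 1
  negPosWalks≢0 {u} {v} ≢0 with ∑≢0⇒∃≢0 (λ k → negPos (A u k) (A k v)) ≢0
  ... | w , term≢0 = w , negPos≢0 (entry u w) (entry w v) term≢0

  sameSignWalks≢0 : ∀ {u v} → sameSignWalks u v ≢ + 0 →
    ∃[ w ] ((A u w ≡ + 1 × A w v ≡ + 1) ⊎ (A u w ≡ - + 1 × A w v ≡ - + 1))
  sameSignWalks≢0 {u} {v} ≢0 with ∑≢0⇒∃≢0 (λ k → sameSign (A u k) (A k v)) ≢0
  ... | w , term≢0 = w , sameSign≢0 (entry u w) (entry w v) term≢0

  module WithDegrees (r : ℕ) (ρ : ℤ) (regular : Regular A r) (netRegular : NetRegular A ρ) where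

    colSum : ∀ j → ∑ (λ l → A l j) ≡ ρ
    colSum j = trans (∑-cong (λ l → A-sym l j)) (netRegular j)

    Sq-rowSum : ∀ i → ∑ (Sq A i) ≡ ρ * ρ
    Sq-rowSum i = begin
      ∑ (λ j → ∑ (λ k → A i k * A k j))  ≡⟨ ∑-swap (λ k j → A i k * A k j) ⟨
      ∑ (λ k → ∑ (λ j → A i k * A k j))  ≡⟨ ∑-cong (λ k → ∑-*ˡ (A i k) (A k)) ⟩
      ∑ (λ k → A i k * ∑ (A k))          ≡⟨ ∑-cong (λ k → cong (A i k *_) (netRegular k)) ⟩
      ∑ (λ k → A i k * ρ)                ≡⟨ ∑-*ʳ ρ (A i) ⟩
      ∑ (A i) * ρ                        ≡⟨ cong (_* ρ) (netRegular i) ⟩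
      ρ * ρ                              ∎
      where open ≡-Reasoning

    twice-d⁺ : ∀ u → ∑ (λ k → abs (A u k) + A u k) ≡ + r + ρ
    twice-d⁺ u = trans (∑-+ (λ k → abs (A u k)) (A u)) (cong₂ _+_ (regular u) (netRegular u))

    twice-d⁻ : ∀ u → ∑ (λ k → abs (A u k) - A u k) ≡ + r - ρ
    twice-d⁻ u = trans (∑-- (λ k → abs (A u k)) (A u)) (cong₂ _-_ (regular u) (netRegular u))

    negPosWalks-rowSum : ∀ i → ∑ (negPosWalks i) ≡ (+ r - ρ) * (+ r + ρ)
    negPosWalks-rowSum i = begin
      ∑ (λ j → ∑ (λ k → negPos (A i k) (A k j)))  ≡⟨ ∑-swap (λ k j → negPos (A i k) (A k j)) ⟨
      ∑ (λ k → ∑ (λ j → negPos (A i k) (A k j)))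
        ≡⟨ ∑-cong (λ k → ∑-*ˡ (abs (A i k) - A i k) (λ j → abs (A k j) + A k j)) ⟩
      ∑ (λ k → (abs (A i k) - A i k) * ∑ (λ j → abs (A k j) + A k j))
        ≡⟨ ∑-cong (λ k → cong ((abs (A i k) - A i k) *_) (twice-d⁺ k)) ⟩
      ∑ (λ k → (abs (A i k) - A i k) * (+ r + ρ))  ≡⟨ ∑-*ʳ (+ r + ρ) (λ k → abs (A i k) - A i k) ⟩
      ∑ (λ k → abs (A i k) - A i k) * (+ r + ρ)    ≡⟨ cong (_* (+ r + ρ)) (twice-d⁻ i) ⟩
      (+ r - ρ) * (+ r + ρ)                        ∎
      where open ≡-Reasoning

    nonAdj : Fin n → Fin n → ℤ
    nonAdj i j = + 1 - abs (A i j) - δ i j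

    nonAdj-rowSum : ∀ i → ∑ (nonAdj i) ≡ + n - + r - + 1
    nonAdj-rowSum i = begin
      ∑ (nonAdj i)                                ≡⟨ ∑-- (λ j → + 1 - abs (A i j)) (δ i) ⟩
      ∑ (λ j → + 1 - abs (A i j)) - ∑ (δ i)       ≡⟨ cong (_-_ (∑ (λ j → + 1 - abs (A i j)))) (∑-δ-one i) ⟩
      ∑ (λ j → + 1 - abs (A i j)) - + 1           ≡⟨ cong (_- + 1) (∑-- (λ _ → + 1) (λ j → abs (A i j))) ⟩
      ∑ {n} (λ _ → + 1) - ∑ (λ j → abs (A i j)) - + 1  ≡⟨ cong₂ (λ x y → x - y - + 1) (∑-one n) (regular i) ⟩
      + n - + r - + 1                             ∎
      where open ≡-Reasoning

    nonAdj-≁ : ∀ {i j} → i ≁ j → nonAdj i j ≡ + 1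
    nonAdj-≁ (i≢j , Aij≡0) = cong₂ (λ x d → + 1 - abs x - d) Aij≡0 (δ-≢ i≢j)

    nonAdj-cases : ∀ i j → nonAdj i j ≡ + 0 ⊎ (i ≁ j × nonAdj i j ≡ + 1)
    nonAdj-cases i j with δ-cases i j
    ... | inj₁ (refl , δ≡1) = inj₁ (cong₂ (λ x d → + 1 - abs x - d) (A-diag i) δ≡1)
    ... | inj₂ (i≢j , δ≡0) with entry i j
    ...   | inj₁ Aij≡0         = inj₂ ((i≢j , Aij≡0) , nonAdj-≁ (i≢j , Aij≡0))
    ...   | inj₂ (inj₁ Aij≡+1) = inj₁ (cong₂ (λ x d → + 1 - abs x - d) Aij≡+1 δ≡0)
    ...   | inj₂ (inj₂ Aij≡-1) = inj₁ (cong₂ (λ x d → + 1 - abs x - d) Aij≡-1 δ≡0)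

    nonAdj≢0 : ∀ {i j} → nonAdj i j ≢ + 0 → i ≁ j
    nonAdj≢0 {i} {j} ≢0 with nonAdj-cases i j
    ... | inj₁ ≡0         = ⊥-elim (≢0 ≡0)
    ... | inj₂ (i≁j , _) = i≁j

    nonAdj-0or1 : ∀ i → ZeroOr 1 (nonAdj i)
    nonAdj-0or1 i j with nonAdj-cases i j
    ... | inj₁ ≡0       = inj₁ ≡0
    ... | inj₂ (_ , ≡1) = inj₂ ≡1

    nonAdj-adj : ∀ {i j} → A i j ≢ + 0 → nonAdj i j ≡ + 0
    nonAdj-adj {i} {j} Aij≢0 with nonAdj-cases i j
    ... | inj₁ ≡0              = ≡0
    ... | inj₂ ((_ , Aij≡0) , _) = ⊥-elim (Aij≢0 Aij≡0)

    module StronglyRegular (a b c : ℤ)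
      (Sq-diag : ∀ i → Sq A i i ≡ + r)
      (Sq-pos : ∀ i j → A i j ≡ + 1 → Sq A i j ≡ a)
      (Sq-neg : ∀ i j → A i j ≡ - + 1 → Sq A i j ≡ b)
      (Sq-non : ∀ i j → i ≢ j → A i j ≡ + 0 → Sq A i j ≡ c)
      where

      κ θ μ : ℤ
      κ = a + b - + 2 * c
      θ = a - b
      μ = + 2 * + r - + 2 * c

      twice-Sq : ∀ k j → + 2 * Sq A k j ≡ + 2 * c + κ * abs (A k j) + θ * A k j + μ * δ k j
      twice-Sq k j with δ-cases k j
      ... | inj₁ (refl , δ≡1) rewrite Sq-diag k | A-diag k | δ≡1 = diagonal a b c (+ r)
        where
        diagonal : ∀ a b c r → + 2 * r ≡ + 2 * c + (a + b - + 2 * c) * + 0 + (a - b) * + 0 + (+ 2 * r - + 2 * c) * + 1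
        diagonal = solve-∀
      ... | inj₂ (k≢j , δ≡0) rewrite δ≡0 with entry k j
      ...   | inj₁ Akj≡0 rewrite Sq-non k j k≢j Akj≡0 | Akj≡0 = nonEdge a b c (+ r)
        where
        nonEdge : ∀ a b c r → + 2 * c ≡ + 2 * c + (a + b - + 2 * c) * + 0 + (a - b) * + 0 + (+ 2 * r - + 2 * c) * + 0
        nonEdge = solve-∀
      ...   | inj₂ (inj₁ Akj≡+1) rewrite Sq-pos k j Akj≡+1 | Akj≡+1 = posEdge a b c (+ r)
        where
        posEdge : ∀ a b c r → + 2 * a ≡ + 2 * c + (a + b - + 2 * c) * + 1 + (a - b) * + 1 + (+ 2 * r - + 2 * c) * + 0
        posEdge = solve-∀
      ...   | inj₂ (inj₂ Akj≡-1) rewrite Sq-neg k j Akj≡-1 | Akj≡-1 = negEdge a b c (+ r)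
        where
        negEdge : ∀ a b c r → + 2 * b ≡ + 2 * c + (a + b - + 2 * c) * + 1 + (a - b) * - + 1 + (+ 2 * r - + 2 * c) * + 0
        negEdge = solve-∀

      order-equation : Fin n → + 2 * (ρ * ρ) ≡ + 2 * c * + n + κ * + r + θ * ρ + μ
      order-equation i = begin
        + 2 * (ρ * ρ)                ≡⟨ cong (+ 2 *_) (Sq-rowSum i) ⟨
        + 2 * ∑ (Sq A i)             ≡⟨ ∑-*ˡ (+ 2) (Sq A i) ⟨
        ∑ (λ j → + 2 * Sq A i j)
          ≡⟨ ∑-cong (λ j → trans (twice-Sq i j)
               (sym (cong (λ x → x + κ * abs (A i j) + θ * A i j + μ * δ i j) (ℤ.*-identityʳ (+ 2 * c))))) ⟩
        ∑ (λ j → + 2 * c * + 1 + κ * abs (A i j) + θ * A i j + μ * δ i j)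
          ≡⟨ ∑-linear (+ 2 * c) κ θ μ (λ _ → + 1) (λ j → abs (A i j)) (A i) (δ i) ⟩
        + 2 * c * ∑ {n} (λ _ → + 1) + κ * ∑ (λ j → abs (A i j)) + θ * ∑ (A i) + μ * ∑ (δ i)
          ≡⟨ cong₂ _+_ (cong₂ _+_ (cong₂ _+_ (cong (+ 2 * c *_) (∑-one n)) (cong (κ *_) (regular i)))
                                  (cong (θ *_) (netRegular i)))
                       (trans (cong (μ *_) (∑-δ-one i)) (ℤ.*-identityʳ μ)) ⟩
        + 2 * c * + n + κ * + r + θ * ρ + μ ∎
        where open ≡-Reasoning

      private
        expandˡ : ∀ x {s y z d} → + 2 * s ≡ + 2 * c + κ * y + θ * z + μ * d →
                  + 2 * (x * s) ≡ + 2 * c * x + κ * (x * y) + θ * (x * z) + μ * (x * d)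
        expandˡ x {s} {y} {z} {d} 2s≡ = begin
          + 2 * (x * s)
            ≡⟨ swap x (+ 2) s ⟨
          x * (+ 2 * s)
            ≡⟨ cong (x *_) 2s≡ ⟩
          x * (+ 2 * c + κ * y + θ * z + μ * d)
            ≡⟨ *-distribˡ-+₄ x (+ 2 * c) (κ * y) (θ * z) (μ * d) ⟩
          x * (+ 2 * c) + x * (κ * y) + x * (θ * z) + x * (μ * d)
            ≡⟨ cong₂ _+_ (cong₂ _+_ (cong₂ _+_ (ℤ.*-comm x (+ 2 * c)) (swap x κ y)) (swap x θ z)) (swap x μ d) ⟩
          + 2 * c * x + κ * (x * y) + θ * (x * z) + μ * (x * d) ∎
          where
          open ≡-Reasoning
          swap : ∀ x k y → x * (k * y) ≡ k * (x * y)
          swap = solve-∀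

        expandʳ : ∀ x {s y z d} → + 2 * s ≡ + 2 * c + κ * y + θ * z + μ * d →
                  + 2 * (s * x) ≡ + 2 * c * x + κ * (y * x) + θ * (z * x) + μ * (d * x)
        expandʳ x {s} {y} {z} {d} 2s≡ = begin
          + 2 * (s * x)
            ≡⟨ ℤ.*-assoc (+ 2) s x ⟨
          + 2 * s * x
            ≡⟨ cong (_* x) 2s≡ ⟩
          (+ 2 * c + κ * y + θ * z + μ * d) * x
            ≡⟨ *-distribʳ-+₄ x (+ 2 * c) (κ * y) (θ * z) (μ * d) ⟩
          + 2 * c * x + κ * y * x + θ * z * x + μ * d * x
            ≡⟨ cong₂ _+_ (cong₂ _+_ (cong (_+_ (+ 2 * c * x)) (ℤ.*-assoc κ y x)) (ℤ.*-assoc θ z x)) (ℤ.*-assoc μ d x) ⟩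
          + 2 * c * x + κ * (y * x) + θ * (z * x) + μ * (d * x) ∎
          where open ≡-Reasoning

      twice-A·Sq : ∀ i j → + 2 * ∑ (λ k → A i k * Sq A k j) ≡
        + 2 * c * ρ + κ * ∑ (λ k → A i k * abs (A k j)) + θ * Sq A i j + μ * A i j
      twice-A·Sq i j = begin
        + 2 * ∑ (λ k → A i k * Sq A k j)
          ≡⟨ ∑-*ˡ (+ 2) (λ k → A i k * Sq A k j) ⟨
        ∑ (λ k → + 2 * (A i k * Sq A k j))
          ≡⟨ ∑-cong (λ k → expandˡ (A i k) (twice-Sq k j)) ⟩
        ∑ (λ k → + 2 * c * A i k + κ * (A i k * abs (A k j)) + θ * (A i k * A k j) + μ * (A i k * δ k j))
          ≡⟨ ∑-linear (+ 2 * c) κ θ μ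
               (A i) (λ k → A i k * abs (A k j)) (λ k → A i k * A k j) (λ k → A i k * δ k j) ⟩
        + 2 * c * ∑ (A i) + κ * ∑ (λ k → A i k * abs (A k j)) + θ * Sq A i j + μ * ∑ (λ k → A i k * δ k j)
          ≡⟨ cong₂ (λ s t → + 2 * c * s + κ * ∑ (λ k → A i k * abs (A k j)) + θ * Sq A i j + μ * t)
                   (netRegular i) (∑-δʳ (A i) j) ⟩
        + 2 * c * ρ + κ * ∑ (λ k → A i k * abs (A k j)) + θ * Sq A i j + μ * A i j ∎
        where open ≡-Reasoning

      twice-Sq·A : ∀ i j → + 2 * ∑ (λ k → Sq A i k * A k j) ≡
        + 2 * c * ρ + κ * ∑ (λ k → abs (A i k) * A k j) + θ * Sq A i j + μ * A i j
      twice-Sq·A i j = begin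
        + 2 * ∑ (λ k → Sq A i k * A k j)
          ≡⟨ ∑-*ˡ (+ 2) (λ k → Sq A i k * A k j) ⟨
        ∑ (λ k → + 2 * (Sq A i k * A k j))
          ≡⟨ ∑-cong (λ k → expandʳ (A k j) (twice-Sq i k)) ⟩
        ∑ (λ k → + 2 * c * A k j + κ * (abs (A i k) * A k j) + θ * (A i k * A k j) + μ * (δ i k * A k j))
          ≡⟨ ∑-linear (+ 2 * c) κ θ μ
               (λ k → A k j) (λ k → abs (A i k) * A k j) (λ k → A i k * A k j) (λ k → δ i k * A k j) ⟩
        + 2 * c * ∑ (λ k → A k j) + κ * ∑ (λ k → abs (A i k) * A k j) + θ * Sq A i j + μ * ∑ (λ k → δ i k * A k j)
          ≡⟨ cong₂ (λ s t → + 2 * c * s + κ * ∑ (λ k → abs (A i k) * A k j) + θ * Sq A i j + μ * t)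
                   (colSum j) (∑-δˡ (λ k → A k j) i) ⟩
        + 2 * c * ρ + κ * ∑ (λ k → abs (A i k) * A k j) + θ * Sq A i j + μ * A i j ∎
        where open ≡-Reasoning

      -- A commutes with A², hence with the |A| term of twice-Sq whenever its coefficient κ is nonzero.
      ∣A∣-commutes : κ ≢ + 0 → ∣A∣-Commutes
      ∣A∣-commutes κ≢0 i j = ℤ.*-cancelˡ-≡ κ W W′ ⦃ ≢-nonZero κ≢0 ⦄
        (∙-cancelˡ (+ 2 * c * ρ) _ _ (∙-cancelʳ (θ * Sq A i j) _ _ (∙-cancelʳ (μ * A i j) _ _
          (trans (sym (twice-A·Sq i j)) (trans (cong (+ 2 *_) (Sq-assoc A i j)) (twice-Sq·A i j))))))
        where
        W W′ : ℤ
        W  = ∑ (λ k → A i k * abs (A k j))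
        W′ = ∑ (λ k → abs (A i k) * A k j)

-- Parity and the order equation

regular⇒2∣r*n : ∀ {n} (A : Mat n) r → (∀ i j → A i j ≡ A j i) → (∀ i → A i i ≡ + 0) →
  Regular A r → 2 ∣ r ℕ.* n
regular⇒2∣r*n {n} A r A-sym A-diag regular
  with handshake (λ i j → abs (A i j)) (λ i j → cong abs (A-sym i j)) (λ i → cong abs (A-diag i))
... | t , ∑∑≡t+t = divides ∣ t ∣ (begin
  r ℕ.* n           ≡⟨ cong ∣_∣ (trans (sym ∑∑≡r*n) ∑∑≡t+t) ⟩
  ∣ t + t ∣         ≡⟨ cong ∣_∣ (double t) ⟩
  ∣ t * + 2 ∣       ≡⟨ ℤ.abs-* t (+ 2) ⟩
  ∣ t ∣ ℕ.* 2       ∎)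
  where
  open ≡-Reasoning
  double : ∀ t → t + t ≡ t * + 2
  double = solve-∀
  ∑∑≡r*n : ∑ (λ i → ∑ (λ j → abs (A i j))) ≡ + (r ℕ.* n)
  ∑∑≡r*n = begin
    ∑ (λ i → ∑ (λ j → abs (A i j)))  ≡⟨ ∑-cong regular ⟩
    ∑ {n} (λ _ → + r)                ≡⟨ ∑-cong {n} (λ _ → ℤ.*-identityʳ (+ r)) ⟨
    ∑ {n} (λ _ → + r * + 1)          ≡⟨ ∑-*ˡ {n} (+ r) (λ _ → + 1) ⟩
    + r * ∑ {n} (λ _ → + 1)          ≡⟨ cong (+ r *_) (∑-one n) ⟩
    + r * + n                        ≡⟨ ℤ.pos-* r n ⟨
    + (r ℕ.* n)                      ∎

5*n-even⇒n-even : ∀ {n} → 2 ∣ 5 ℕ.* n → 2 ∣ n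
5*n-even⇒n-even = coprime-divisor (toWitness {a? = coprime? 2 5} tt)

order-cases : ∀ q c → 5 ℕ.≤ q ℕ.* 2 → c * (+ q - + 3) ≡ - + 3 →
  (q ≡ 4 × c ≡ - + 3) ⊎ (q ≡ 6 × c ≡ - + 1)
order-cases 0 c () _
order-cases 1 c (ℕ.s≤s (ℕ.s≤s ())) _
order-cases 2 c (ℕ.s≤s (ℕ.s≤s (ℕ.s≤s (ℕ.s≤s ())))) _
order-cases 3 c _ eq with trans (sym (ℤ.*-zeroʳ c)) eq
... | ()
order-cases 4 c _ eq = inj₁ (refl , trans (sym (ℤ.*-identityʳ c)) eq)
order-cases 5 c _ eq =
  ⊥-elim (toWitnessFalse {a? = 2 ∣? 3} tt (divides ∣ c ∣ (trans (cong ∣_∣ (sym eq)) (ℤ.abs-* c (+ 2)))))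
order-cases 6 c _ eq = inj₂ (refl , ℤ.*-cancelʳ-≡ c (- + 1) (+ 3) eq)
order-cases (suc (suc (suc (suc (suc (suc (suc r))))))) c _ eq
  with ∣⇒≤ (divides ∣ c ∣ (trans (cong ∣_∣ (sym eq)) (ℤ.abs-* c (+ (4 ℕ.+ r)))))
... | ℕ.s≤s (ℕ.s≤s (ℕ.s≤s ()))

module FiveRegular {n : ℕ} (A : Mat n)
  (entry : ∀ i j → Entry (A i j))
  (A-sym : ∀ i j → A i j ≡ A j i)
  (A-diag : ∀ i → A i i ≡ + 0)
  (regular : Regular A 5)
  (netRegular : NetRegular A (+ 1))
  (c : ℤ)
  (Sq-diag : ∀ i → Sq A i i ≡ + 5)
  (Sq-pos : ∀ i j → A i j ≡ + 1 → Sq A i j ≡ + 0)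
  (Sq-neg : ∀ i j → A i j ≡ - + 1 → Sq A i j ≡ + 1)
  (Sq-non : ∀ i j → i ≢ j → A i j ≡ + 0 → Sq A i j ≡ c)
  where

  open SignedGraph A entry A-sym A-diag
  open WithDegrees 5 (+ 1) regular netRegular
  open StronglyRegular (+ 0) (+ 1) c Sq-diag Sq-pos Sq-neg Sq-non

  κ≢0 : κ ≢ + 0
  κ≢0 κ≡0 = toWitnessFalse {a? = 2 ∣? 1} tt (divides ∣ c ∣ (trans (cong ∣_∣ 1≡c*2) (ℤ.abs-* c (+ 2))))
    where
    split : ∀ c → + 1 ≡ (+ 0 + + 1 - + 2 * c) + c * + 2
    split = solve-∀
    1≡c*2 : + 1 ≡ c * + 2
    1≡c*2 = trans (split c) (trans (cong (_+ c * + 2) κ≡0) (ℤ.+-identityˡ (c * + 2)))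

  common≡ : ∀ i j → common i j ≡ Sq A i j + negPosWalks i j
  common≡ = common≡Sq+negPosWalks (∣A∣-commutes κ≢0)

  5≤n : Fin n → 5 ℕ.≤ n
  5≤n i with subst₂ _≤_ (regular i) (∑-one n) (∑-mono (λ k → abs≤1 (entry i k)))
  ... | +≤+ 5≤n = 5≤n

  half-order-equation : ∀ q → n ≡ q ℕ.* 2 → Fin n → c * (+ q - + 3) ≡ - + 3
  half-order-equation q n≡2q i = begin
    c * (+ q - + 3)                  ≡⟨ shift (c * (+ q - + 3)) ⟩
    c * (+ q - + 3) + + 3 - + 3      ≡⟨ cong (_- + 3) (ℤ.*-cancelˡ-≡ (+ 4) _ (+ 0) four-times) ⟩
    + 0 - + 3                        ∎
    where
    open ≡-Reasoning
    shift : ∀ x → x ≡ x + + 3 - + 3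
    shift = solve-∀
    rearrange : ∀ c q → + 4 * (c * (q - + 3) + + 3) ≡
      + 2 * c * (q * + 2) + (+ 0 + + 1 - + 2 * c) * + 5 + (+ 0 - + 1) * + 1 + (+ 2 * + 5 - + 2 * c) - + 2 * (+ 1 * + 1)
    rearrange = solve-∀
    four-times : + 4 * (c * (+ q - + 3) + + 3) ≡ + 4 * + 0
    four-times = trans (rearrange c (+ q))
      (trans (cong (λ m → + 2 * c * m + κ * + 5 + θ * + 1 + μ - + 2 * (+ 1 * + 1))
                   (trans (sym (ℤ.pos-* q 2)) (cong +_ (sym n≡2q))))
             (ℤ.i≡j⇒i-j≡0 (sym (order-equation i))))

  module Order12 (c≡-1 : c ≡ - + 1) (n≡12 : n ≡ 12) where

    nonAdj-row : ∀ i → ∑ (nonAdj i) ≡ + 6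
    nonAdj-row i = trans (nonAdj-rowSum i) (cong (λ m → + m - + 5 - + 1) n≡12)

    Sq-≁ : ∀ {i j} → i ≁ j → Sq A i j ≡ - + 1
    Sq-≁ {i} {j} (i≢j , Aij≡0) = trans (Sq-non i j i≢j Aij≡0) c≡-1

    negPosWalks-≁ : ∀ {i j} → i ≁ j → + 4 ≤ negPosWalks i j
    negPosWalks-≁ {i} {j} i≁j =
      ∑-ZeroOr-≢0 4 (λ k → negPos (A i k) (A k j)) (negPosWalks-0or4 i j) F≢0
      where
      F≢0 : negPosWalks i j ≢ + 0
      F≢0 F≡0 = infeasible tt
        (subst (+ 0 ≤_) (trans (common≡ i j) (cong₂ _+_ (Sq-≁ i≁j) F≡0)) (common-nonNeg i j))

    -- Each of the 6 non-neighbours of i needs 4 from the total 24, so all the inequalities are tight.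
    negPosWalks≡4·nonAdj : ∀ i j → negPosWalks i j ≡ + 4 * nonAdj i j
    negPosWalks≡4·nonAdj i j = ℤ.i-j≡0⇒i≡j _ _ (∑≡0⇒≡0 excess excess-nonNeg ∑excess≡0 j)
      where
      excess : Fin n → ℤ
      excess k = negPosWalks i k - + 4 * nonAdj i k
      excess-nonNeg : NonNeg excess
      excess-nonNeg k with nonAdj-cases i k
      ... | inj₁ ν≡0 =
        ℤ.i≤j⇒0≤j-i (subst (_≤ negPosWalks i k) (cong (+ 4 *_) (sym ν≡0)) (negPosWalks-nonNeg i k))
      ... | inj₂ (i≁k , ν≡1) =
        ℤ.i≤j⇒0≤j-i (subst (_≤ negPosWalks i k) (cong (+ 4 *_) (sym ν≡1)) (negPosWalks-≁ i≁k))
      ∑excess≡0 : ∑ excess ≡ + 0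
      ∑excess≡0 = trans (∑-- (negPosWalks i) (λ k → + 4 * nonAdj i k))
        (cong₂ _-_ (negPosWalks-rowSum i) (trans (∑-*ˡ (+ 4) (nonAdj i)) (cong (+ 4 *_) (nonAdj-row i))))

    negPosWalks-adj : ∀ {u v} → A u v ≢ + 0 → negPosWalks u v ≡ + 0
    negPosWalks-adj Auv≢0 = trans (negPosWalks≡4·nonAdj _ _) (cong (+ 4 *_) (nonAdj-adj Auv≢0))

    negPosWalks-≁≡4 : ∀ {u v} → u ≁ v → negPosWalks u v ≡ + 4
    negPosWalks-≁≡4 u≁v = trans (negPosWalks≡4·nonAdj _ _) (cong (+ 4 *_) (nonAdj-≁ u≁v))

    posEdge-noCommon : ∀ {u v} → A u v ≡ + 1 → ∀ w → abs (A u w) * abs (A w v) ≡ + 0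
    posEdge-noCommon {u} {v} Auv≡1 = ∑≡0⇒≡0 _ (λ k → abs*abs-nonNeg (A u k) (A k v))
      (trans (common≡ u v) (cong₂ _+_ (Sq-pos u v Auv≡1) (negPosWalks-adj (≡suc⇒≢0 Auv≡1))))

    negEdge-sameSignPath : ∀ {u v} → A u v ≡ - + 1 →
      ∃[ w ] ((A u w ≡ + 1 × A w v ≡ + 1) ⊎ (A u w ≡ - + 1 × A w v ≡ - + 1))
    negEdge-sameSignPath {u} {v} Auv≡-1 = sameSignWalks≢0 (≡suc⇒≢0 (begin
      sameSignWalks u v                           ≡⟨ sameSignWalks≡ u v ⟩
      common u v + Sq A u v                       ≡⟨ cong (_+ Sq A u v) (common≡ u v) ⟩
      Sq A u v + negPosWalks u v + Sq A u v       ≡⟨ cong₂ (λ s f → s + f + s) (Sq-neg u v Auv≡-1) (negPosWalks-adj Auv≢0) ⟩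
      + 2                                         ∎))
      where
      open ≡-Reasoning
      Auv≢0 : A u v ≢ + 0
      Auv≢0 Auv≡0 with trans (sym Auv≡-1) Auv≡0
      ... | ()

    common-≁ : ∀ {u v} → u ≁ v → common u v ≡ + 3
    common-≁ {u} {v} u≁v = trans (common≡ u v) (cong₂ _+_ (Sq-≁ u≁v) (negPosWalks-≁≡4 u≁v))

    ≁-negPosPath : ∀ {u v} → u ≁ v → ∃[ w ] A u w ≡ - + 1 × A w v ≡ + 1
    ≁-negPosPath u≁v = negPosWalks≢0 (≡suc⇒≢0 (negPosWalks-≁≡4 u≁v))

    ≁-sameSignPath : ∀ {u v} → u ≁ v →
      ∃[ w ] ((A u w ≡ + 1 × A w v ≡ + 1) ⊎ (A u w ≡ - + 1 × A w v ≡ - + 1))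
    ≁-sameSignPath {u} {v} u≁v = sameSignWalks≢0 (≡suc⇒≢0
      (trans (sameSignWalks≡ u v) (cong₂ _+_ (common-≁ u≁v) (Sq-≁ u≁v))))

    no-negNegPath : ∀ {i u w} → i ≁ u → A i w ≡ - + 1 → A w u ≡ - + 1 → ⊥
    no-negNegPath {i} {u} {w} (i≢u , Aiu≡0) Aiw≡-1 Awu≡-1 = refute (negEdge-sameSignPath Aiw≡-1)
      where
      refute : ∃[ w′ ] ((A i w′ ≡ + 1 × A w′ w ≡ + 1) ⊎ (A i w′ ≡ - + 1 × A w′ w ≡ - + 1)) → ⊥
      refute (w′ , inj₁ (Aiw′≡1 , Aw′w≡1)) =
        ≡suc⇒≢0 (cong₂ (λ x y → abs x * abs y) Aiw≡-1 (trans (A-sym w w′) Aw′w≡1)) (posEdge-noCommon Aiw′≡1 w)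
      refute (w′ , inj₂ (Aiw′≡-1 , Aw′w≡-1)) = infeasible tt (subst (+ 3 * + 2 ≤_) (twice-d⁻ w)
        (count≤∑ (λ k → abs (A w k) - A w k) (λ k → abs-x-nonNeg (entry w k)) distinct twos))
        where
        distinct : Unique (i ∷ u ∷ w′ ∷ [])
        distinct = (i≢u ∷ ≢-via (A i) (A-diag i) Aiw′≡-1 (λ ()) ∷ [])
                 ∷ (≢-via (A i) Aiu≡0 Aiw′≡-1 (λ ()) ∷ [])
                 ∷ [] ∷ []
        two : ∀ {x} → x ≡ - + 1 → abs x - x ≡ + 2
        two refl = refl
        twos : All (λ k → abs (A w k) - A w k ≡ + 2) (i ∷ u ∷ w′ ∷ [])
        twos = two (trans (A-sym w i) Aiw≡-1) ∷ two Awu≡-1 ∷ two (trans (A-sym w w′) Aw′w≡-1) ∷ []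

    ≁-posPosPath : ∀ {i u} → i ≁ u → ∃[ b ] A i b ≡ + 1 × A b u ≡ + 1
    ≁-posPosPath {i} {u} i≁u = choose (≁-sameSignPath i≁u)
      where
      choose : ∃[ w ] ((A i w ≡ + 1 × A w u ≡ + 1) ⊎ (A i w ≡ - + 1 × A w u ≡ - + 1)) →
               ∃[ b ] A i b ≡ + 1 × A b u ≡ + 1
      choose (b , inj₁ posPos)            = b , posPos
      choose (w , inj₂ (Aiw≡-1 , Awu≡-1)) = ⊥-elim (no-negNegPath i≁u Aiw≡-1 Awu≡-1)

    ≁-posNegPath : ∀ {i u} → i ≁ u → ∃[ a ] A i a ≡ + 1 × A a u ≡ - + 1
    ≁-posNegPath {i} {u} i≁u =
      let a , Aua≡-1 , Aai≡1 = ≁-negPosPath (≁-sym i≁u)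
      in  a , trans (A-sym i a) Aai≡1 , trans (A-sym a u) Aua≡-1

    -- v has 3 positive neighbours, but at most 2 of them are among the 3 common neighbours of i and v.
    ≁-posNeighbour-≁ : ∀ {i v} → i ≁ v → ∃[ s ] A v s ≡ + 1 × i ≁ s
    ≁-posNeighbour-≁ {i} {v} i≁v@(_ , Aiv≡0) = conclude (∑≢0⇒∃≢0 posNonAdj ∑posNonAdj≢0)
      where
      pos posAdj posNonAdj : Fin n → ℤ
      pos k = abs (A k v) + A k v
      posAdj k = pos k * abs (A i k)
      posNonAdj k = pos k * (+ 1 - abs (A i k))
      ∑pos≡6 : ∑ pos ≡ + 6
      ∑pos≡6 = trans (∑-cong (λ k → cong (λ x → abs x + x) (A-sym k v))) (twice-d⁺ v)
      ∑posAdj+2≤6 : ∃[ a ] A i a ≡ + 1 × A a v ≡ - + 1 → ∑ posAdj + + 2 ≤ + 6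
      ∑posAdj+2≤6 (a , Aia≡1 , Aav≡-1) = subst (∑ posAdj + + 2 ≤_)
        (trans (∑-*ˡ (+ 2) (λ k → abs (A i k) * abs (A k v))) (cong (+ 2 *_) (common-≁ i≁v)))
        (∑-mono-gap a (λ k → pos*abs≤2abs*abs (entry i k) (entry k v))
          (ℤ.≤-reflexive (trans (cong₂ (λ x y → (abs y + y) * abs x + + 2) Aia≡1 Aav≡-1)
                                (sym (cong₂ (λ x y → + 2 * (abs x * abs y)) Aia≡1 Aav≡-1)))))
      ∑posNonAdj≡6-∑posAdj : ∑ posNonAdj ≡ + 6 - ∑ posAdj
      ∑posNonAdj≡6-∑posAdj = begin
        ∑ posNonAdj                 ≡⟨ ∑-cong (λ k → distrib (pos k) (abs (A i k))) ⟩
        ∑ (λ k → pos k - posAdj k)  ≡⟨ ∑-- pos posAdj ⟩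
        ∑ pos - ∑ posAdj            ≡⟨ cong (_- ∑ posAdj) ∑pos≡6 ⟩
        + 6 - ∑ posAdj              ∎
        where
        open ≡-Reasoning
        distrib : ∀ y z → y * (+ 1 - z) ≡ y - y * z
        distrib = solve-∀
      ∑posNonAdj≢0 : ∑ posNonAdj ≢ + 0
      ∑posNonAdj≢0 ∑≡0 =
        infeasible tt (subst (λ x → x + + 2 ≤ + 6) ∑posAdj≡6 (∑posAdj+2≤6 (≁-posNegPath i≁v)))
        where
        ∑posAdj≡6 : ∑ posAdj ≡ + 6
        ∑posAdj≡6 = sym (ℤ.i-j≡0⇒i≡j (+ 6) (∑ posAdj) (trans (sym ∑posNonAdj≡6-∑posAdj) ∑≡0))
      conclude : ∃[ s ] posNonAdj s ≢ + 0 → ∃[ s ] A v s ≡ + 1 × i ≁ s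
      conclude (s , ≢0) =
        let Asv≡1 , Ais≡0 = pos*[1-abs]≢0 (entry s v) (entry i s) ≢0
        in  s , trans (A-sym v s) Asv≡1 , ≢-via (λ k → A k v) Aiv≡0 Asv≡1 (λ ()) , Ais≡0

    -- The positive neighbours a, b of i on paths to v and a′, b′ on paths to s are distinct,
    -- because the positive edge v s has no common neighbour.
    no-nonNeighbour : ∀ {i v} → i ≁ v → ⊥
    no-nonNeighbour {i} {v} i≁v = fromPositiveNeighbour (≁-posNeighbour-≁ i≁v)
      where
      fromPositiveNeighbour : ∃[ s ] A v s ≡ + 1 × i ≁ s → ⊥
      fromPositiveNeighbour (s , Avs≡1 , i≁s) =
        fromPaths (≁-posNegPath i≁v) (≁-posPosPath i≁v) (≁-posNegPath i≁s) (≁-posPosPath i≁s)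
        where
        apart : ∀ {x y} → abs (A v x) ≡ + 1 → abs (A y s) ≡ + 1 → x ≢ y
        apart {x} h₁ h₂ refl = ≡suc⇒≢0 (cong₂ _*_ h₁ h₂) (posEdge-noCommon Avs≡1 x)
        viaSym : ∀ {x y} → A x y ≡ + 1 ⊎ A x y ≡ - + 1 → abs (A y x) ≡ + 1
        viaSym {x} {y} (inj₁ Axy≡1)  = cong abs (trans (A-sym y x) Axy≡1)
        viaSym {x} {y} (inj₂ Axy≡-1) = cong abs (trans (A-sym y x) Axy≡-1)
        two : ∀ {x} → x ≡ + 1 → abs x + x ≡ + 2
        two refl = refl
        fromPaths : ∃[ a ] A i a ≡ + 1 × A a v ≡ - + 1 → ∃[ b ] A i b ≡ + 1 × A b v ≡ + 1 →
                    ∃[ a′ ] A i a′ ≡ + 1 × A a′ s ≡ - + 1 → ∃[ b′ ] A i b′ ≡ + 1 × A b′ s ≡ + 1 → ⊥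
        fromPaths (a , Aia≡1 , Aav≡-1) (b , Aib≡1 , Abv≡1) (a′ , Aia′≡1 , Aa′s≡-1) (b′ , Aib′≡1 , Ab′s≡1) =
          infeasible tt (subst (+ 4 * + 2 ≤_) (twice-d⁺ i)
            (count≤∑ (λ k → abs (A i k) + A i k) (λ k → abs+x-nonNeg (entry i k)) distinct twos))
          where
          distinct : Unique (a ∷ b ∷ a′ ∷ b′ ∷ [])
          distinct =
              (≢-via (λ k → A k v) Aav≡-1 Abv≡1 (λ ())
                ∷ apart (viaSym (inj₂ Aav≡-1)) (cong abs Aa′s≡-1)
                ∷ apart (viaSym (inj₂ Aav≡-1)) (cong abs Ab′s≡1) ∷ [])
            ∷ (apart (viaSym (inj₁ Abv≡1)) (cong abs Aa′s≡-1)
                ∷ apart (viaSym (inj₁ Abv≡1)) (cong abs Ab′s≡1) ∷ [])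
            ∷ (≢-via (λ k → A k s) Aa′s≡-1 Ab′s≡1 (λ ()) ∷ [])
            ∷ [] ∷ []
          twos : All (λ k → abs (A i k) + A i k ≡ + 2) (a ∷ b ∷ a′ ∷ b′ ∷ [])
          twos = two Aia≡1 ∷ two Aib≡1 ∷ two Aia′≡1 ∷ two Aib′≡1 ∷ []

    impossible : Fin n → ⊥
    impossible i = no-nonNeighbour (nonAdj≢0 (proj₂ (∑≢0⇒∃≢0 (nonAdj i) (≡suc⇒≢0 (nonAdj-row i)))))

  module Order8 (c≡-3 : c ≡ - + 3) (n≡8 : n ≡ 8) where

    Sq-≁ : ∀ {i j} → i ≁ j → Sq A i j ≡ - + 3
    Sq-≁ {i} {j} (i≢j , Aij≡0) = trans (Sq-non i j i≢j Aij≡0) c≡-3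

    -- sameSignWalks ≥ 0 gives common ≥ 3, so negPosWalks = common + 3 exceeds 4, forcing it to be ≥ 8.
    common-≁ : ∀ {u v} → u ≁ v → common u v ≡ + 5
    common-≁ {u} {v} u≁v = ℤ.≤-antisym common≤5 5≤common
      where
      common≤5 : common u v ≤ + 5
      common≤5 = subst (common u v ≤_) (regular u) (∑-mono (λ k → abs*abs≤abs (abs (A u k)) (entry k v)))
      3≤common : + 3 ≤ common u v
      3≤common = ℤ.0≤i-j⇒j≤i (subst (+ 0 ≤_) (trans (sameSignWalks≡ u v) (cong (_+_ (common u v)) (Sq-≁ u≁v)))
                                                 (sameSignWalks-nonNeg u v))
      F≡common+3 : negPosWalks u v ≡ common u v + + 3
      F≡common+3 = trans (shift (negPosWalks u v))
        (cong (_- - + 3) (sym (trans (common≡ u v) (cong (_+ negPosWalks u v) (Sq-≁ u≁v)))))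
        where
        shift : ∀ x → x ≡ - + 3 + x - - + 3
        shift = solve-∀
      8≤common+3 : + 4 + + 4 ≤ common u v + + 3
      8≤common+3 = subst (+ 4 + + 4 ≤_) F≡common+3
        (∑-ZeroOr-> 4 (λ k → negPos (A u k) (A k v)) (negPosWalks-0or4 u v)
          (ℤ.<-≤-trans (+<+ (ℕ.s≤s (ℕ.s≤s (ℕ.s≤s (ℕ.s≤s (ℕ.s≤s ℕ.z≤n))))))
                       (subst (+ 6 ≤_) (sym F≡common+3) (ℤ.+-monoˡ-≤ (+ 3) 3≤common))))
      5≤common : + 5 ≤ common u v
      5≤common = ℤ.0≤i-j⇒j≤i (subst (+ 0 ≤_) (shift (common u v)) (ℤ.i≤j⇒0≤j-i 8≤common+3))
        where
        shift : ∀ x → x + + 3 - (+ 4 + + 4) ≡ x - + 5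
        shift = solve-∀

    neighbourhood-⊆ : ∀ {u v k} → u ≁ v → abs (A u k) ≡ + 1 → abs (A k v) ≡ + 1
    neighbourhood-⊆ {u} {v} {k} u≁v |Auk|≡1 =
      abs≢0 (entry k v) (λ |Akv|≡0 → ≡suc⇒≢0 (cong₂ (λ x y → x - x * y) |Auk|≡1 |Akv|≡0) (deficit≡0 k))
      where
      deficit : Fin n → ℤ
      deficit m = abs (A u m) - abs (A u m) * abs (A m v)
      deficit≡0 : ∀ m → deficit m ≡ + 0
      deficit≡0 = ∑≡0⇒≡0 deficit (λ m → ℤ.i≤j⇒0≤j-i (abs*abs≤abs (abs (A u m)) (entry m v)))
        (trans (∑-- (λ m → abs (A u m)) (λ m → abs (A u m) * abs (A m v))) (cong₂ _-_ (regular u) (common-≁ u≁v)))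

    two-nonNeighbours : ∀ i → ∃[ j ] ∃[ j′ ] j ≢ j′ × i ≁ j × i ≁ j′
    two-nonNeighbours i =
      let j , j′ , j≢j′ , νj≡1 , νj′≡1 = ∑≡2⇒two-ones (nonAdj i) (nonAdj-0or1 i)
                                           (trans (nonAdj-rowSum i) (cong (λ m → + m - + 5 - + 1) n≡8))
      in  j , j′ , j≢j′ , nonAdj≢0 (≡suc⇒≢0 νj≡1) , nonAdj≢0 (≡suc⇒≢0 νj′≡1)

    -- A common neighbour q of i and a negative neighbour k of i is adjacent to i, k and,
    -- by neighbourhood-⊆, to the two non-neighbours of each: six distinct vertices.
    impossible : Fin n → ⊥
    impossible i = fromNegNeighbour (∑≢0⇒∃≢0 (λ k → abs (A i k) - A i k) (≡suc⇒≢0 (twice-d⁻ i)))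
      where
      fromNegNeighbour : ∃[ k ] abs (A i k) - A i k ≢ + 0 → ⊥
      fromNegNeighbour (k , ≢0) = fromCommon (common≢0 common≢0′) (two-nonNeighbours i) (two-nonNeighbours k)
        where
        Aik≡-1 : A i k ≡ - + 1
        Aik≡-1 = abs-x≢0 (entry i k) ≢0
        common≢0′ : common i k ≢ + 0
        common≢0′ common≡0 = infeasible tt (subst (+ 1 ≤_)
          (trans (sym (trans (common≡ i k) (cong (_+ negPosWalks i k) (Sq-neg i k Aik≡-1)))) common≡0)
          (ℤ.i≤i+j (+ 1) (negPosWalks i k) ⦃ nonNegative (negPosWalks-nonNeg i k) ⦄))
        |Aki|≡1 : abs (A k i) ≡ + 1
        |Aki|≡1 = cong abs (trans (A-sym k i) Aik≡-1)
        fromCommon : ∃[ q ] abs (A i q) ≡ + 1 × abs (A q k) ≡ + 1 →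
                     ∃[ j ] ∃[ j′ ] j ≢ j′ × i ≁ j × i ≁ j′ →
                     ∃[ l ] ∃[ l′ ] l ≢ l′ × k ≁ l × k ≁ l′ → ⊥
        fromCommon (q , |Aiq|≡1 , |Aqk|≡1) (j , j′ , j≢j′ , i≁j , i≁j′) (l , l′ , l≢l′ , k≁l , k≁l′) =
          infeasible tt (subst (+ 6 * + 1 ≤_) (regular q)
            (count≤∑ (λ m → abs (A q m)) (λ m → +≤+ ℕ.z≤n) distinct ones))
          where
          |Akq|≡1 : abs (A k q) ≡ + 1
          |Akq|≡1 = trans (cong abs (A-sym k q)) |Aqk|≡1
          |Aqi|≡1 : abs (A q i) ≡ + 1
          |Aqi|≡1 = trans (cong abs (A-sym q i)) |Aiq|≡1
          ones : All (λ m → abs (A q m) ≡ + 1) (i ∷ k ∷ j ∷ j′ ∷ l ∷ l′ ∷ [])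
          ones = |Aqi|≡1 ∷ |Aqk|≡1
               ∷ neighbourhood-⊆ i≁j |Aiq|≡1 ∷ neighbourhood-⊆ i≁j′ |Aiq|≡1
               ∷ neighbourhood-⊆ k≁l |Akq|≡1 ∷ neighbourhood-⊆ k≁l′ |Akq|≡1 ∷ []
          i≢l : ∀ {l} → k ≁ l → i ≢ l
          i≢l (_ , Akl≡0) = ≢-via (A k) (trans (A-sym k i) Aik≡-1) Akl≡0 (λ ())
          k≢j : ∀ {j} → i ≁ j → k ≢ j
          k≢j (_ , Aij≡0) = ≢-via (A i) Aik≡-1 Aij≡0 (λ ())
          j≢l : ∀ {j l} → i ≁ j → k ≁ l → j ≢ l
          j≢l (_ , Aij≡0) k≁l =
            ≢-via (λ m → abs (A i m)) (cong abs Aij≡0) (neighbourhood-⊆ k≁l |Aki|≡1) (λ ())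
          distinct : Unique (i ∷ k ∷ j ∷ j′ ∷ l ∷ l′ ∷ [])
          distinct = (≢-via (A i) (A-diag i) Aik≡-1 (λ ())
                        ∷ proj₁ i≁j ∷ proj₁ i≁j′ ∷ i≢l k≁l ∷ i≢l k≁l′ ∷ [])
                   ∷ (k≢j i≁j ∷ k≢j i≁j′ ∷ proj₁ k≁l ∷ proj₁ k≁l′ ∷ [])
                   ∷ (j≢j′ ∷ j≢l i≁j k≁l ∷ j≢l i≁j k≁l′ ∷ [])
                   ∷ (j≢l i≁j′ k≁l ∷ j≢l i≁j′ k≁l′ ∷ [])
                   ∷ (l≢l′ ∷ [])
                   ∷ [] ∷ []

  impossible : Fin n → ⊥
  impossible i = fromEvenOrder (5*n-even⇒n-even (regular⇒2∣r*n A 5 A-sym A-diag regular))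
    where
    byCases : ∀ q → n ≡ q ℕ.* 2 → (q ≡ 4 × c ≡ - + 3) ⊎ (q ≡ 6 × c ≡ - + 1) → ⊥
    byCases q n≡8  (inj₁ (refl , c≡-3)) = Order8.impossible c≡-3 n≡8 i
    byCases q n≡12 (inj₂ (refl , c≡-1)) = Order12.impossible c≡-1 n≡12 i
    fromEvenOrder : 2 ∣ n → ⊥
    fromEvenOrder (divides q n≡q*2) =
      byCases q n≡q*2 (order-cases q c (subst (5 ℕ.≤_) n≡q*2 (5≤n i)) (half-order-equation q n≡q*2 i))


lemma3p9 : (n : ℕ) (A : Mat n) (a b c : ℤ) →
    IsSignedGraph A → IsSRSG A 5 a b c → Inhomogeneous A →
    (C₁ A a b c ⊎ C₄ A a b c ⊎ C₅ A a b c) →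
    Connected A → ¬ Complete A → Regular A 5 → NetRegular A (+ 1) →
    ¬ (a ≡ + 0 × b ≡ + 1)
lemma3p9 n A a b c (entry , A-sym , A-diag) (_ , _ , Sq-diag , Sq-pos , Sq-neg , Sq-non) ((i , _) , _) _ _ _
  regular netRegular (refl , refl) =
  FiveRegular.impossible A entry A-sym A-diag regular netRegular c Sq-diag Sq-pos Sq-neg Sq-non i
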